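{- Let $\mathcal{F}$ be the M-NAE version of a set $\mathcal{C}$ of 3-literal clauses, let $N=|U_3|$, and suppose $\mathcal{F}$ has a NAE truth assignment. Then every NAE truth assignment of $\mathcal{F}$ with a minimum number of true variables satisfies: (i) for each $g\in U_2\setminus\{z\}$, exactly one of $\alpha_g,\beta_g$ is true; (ii) for each $g\in U_2\setminus\{z\}$, exactly one of $a_g,b_g,c_g$ is true. Consequently, $\frac{2(N-1)}{5}\le t_{NAE}(\mathcal{F})\le\frac{2(N-1)}{5}+1$. The lower value is attained iff $z$ is false, and the upper value iff $z$ is true, in such a minimum assignment.
   Context: The clauses. Let $X=\{x_1,\dots,x_n\}$ and let $\mathcal{C}=\{C_1,\dots,C_m\}$. Each clause involves three distinct variables and is written $C_r=(l_i\vee l_j\vee l_k)$ with $i<j<k$ and $l_u\in\{x_u,\overline{x_u}\}$. The variables. Let $U_2=\{y_1,\dots,y_n,w_1,\dots,w_m,z\}$ and $U_3=\{z\}\cup\bigcup_{g\in U_2\setminus\{z\}}\{\alpha_g,\beta_g,a_g,b_g,c_g\}$. The M-NAE version $\mathcal{F}$ is the following set of monotone clauses over $U_3$: - for each $C_r$, the clauses $(\gamma_i\vee\gamma_j\vee\alpha_{w_r})$ and $(\beta_{w_r}\vee\gamma_k\vee z)$, where $\gamma_u=\alpha_{y_u}$ if $l_u=x_u$ and $\gamma_u=\beta_{y_u}$ if $l_u=\overline{x_u}$; - for each $g\in U_2\setminus\{z\}$, the clauses $(\alpha_g\vee\beta_g\vee a_g)$, $(\alpha_g\vee\beta_g\vee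 b_g)$, $(\alpha_g\vee\beta_g\vee c_g)$ and $(a_g\vee b_g\vee c_g)$. A NAE truth assignment makes every clause contain at least one true and at least one false literal. $t_{NAE}(\mathcal{F})$ is the minimum number of true variables in a NAE truth assignment of $\mathcal{F}$. -}

module Defs where

open import Data.Nat using (ℕ; _+_; _*_; _∸_; _≤_)
open import Data.Bool using (Bool; true; false; _∨_; _∧_; not; if_then_else_)
open import Data.Fin using (Fin)
open import Data.Fin.Base using () renaming (_<_ to _<ᶠ_)
open import Data.Sum using (_⊎_; inj₁; inj₂)
open import Data.Product using (Σ; _×_; _,_)
open import Data.List using (List; []; _∷_; map; concatMap; length; _++_; allFin)
open import Data.Nat.ListAction using (sum)
open import Data.List.Relation.Unary.All using (All)
open import Data.Vec using (Vec; lookup)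
open import Relation.Binary.PropositionalEquality using (_≡_)

-- A 3-literal clause over x_1..x_n: variables i < j < k, with polarities
-- (true = positive literal x_u, false = negated literal ¬x_u).
record Clause (n : ℕ) : Set where
  constructor clause
  field
    i j k    : Fin n
    i<j      : i <ᶠ j
    j<k      : j <ᶠ k
    pi pj pk : Bool

-- U₂ \ {z}: y_1..y_n (inj₁) and w_1..w_m (inj₂)
G : ℕ → ℕ → Set
G n m = Fin n ⊎ Fin m

data V (n m : ℕ) : Set where
  z : V n m
  α β a b c : G n m → V n m

allG : (n m : ℕ) → List (G n m)
allG n m = map inj₁ (allFin n) ++ map inj₂ (allFin m)

allV : (n m : ℕ) → List (V n m)
allV n m = z ∷ concatMap (λ g → α g ∷ β g ∷ a g ∷ b g ∷ c g ∷ []) (allG n m)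

N : ℕ → ℕ → ℕ
N n m = length (allV n m)

MClause : ℕ → ℕ → Set
MClause n m = V n m × V n m × V n m

γ : ∀ {n m} → Fin n → Bool → V n m
γ u true  = α (inj₁ u)
γ u false = β (inj₁ u)

clausesOfC : ∀ {n m} → Fin m → Clause n → List (MClause n m)
clausesOfC r (clause i j k _ _ pi pj pk) =
  (γ i pi , γ j pj , α (inj₂ r)) ∷ (β (inj₂ r) , γ k pk , z) ∷ []

gadget : ∀ {n m} → G n m → List (MClause n m)
gadget g =
  (α g , β g , a g) ∷ (α g , β g , b g) ∷ (α g , β g , c g) ∷ (a g , b g , c g) ∷ []

MNAE : ∀ {n m} → Vec (Clause n) m → List (MClause n m)
MNAE {n} {m} C =
  concatMap (λ r → clausesOfC r (lookup C r)) (allFin m)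
  ++ concatMap gadget (allG n m)

Assignment : ℕ → ℕ → Set
Assignment n m = V n m → Bool

NAEClause : ∀ {n m} → Assignment n m → MClause n m → Set
NAEClause σ (p , q , r) = ((σ p ∨ σ q ∨ σ r) ≡ true) × ((σ p ∧ σ q ∧ σ r) ≡ false)

IsNAE : ∀ {n m} → List (MClause n m) → Assignment n m → Set
IsNAE F σ = All (NAEClause σ) F

b2n : Bool → ℕ
b2n true = 1
b2n false = 0

countTrue : ∀ {n m} → Assignment n m → ℕ
countTrue {n} {m} σ = sum (map (λ v → b2n (σ v)) (allV n m))

IsMinNAE : ∀ {n m} → List (MClause n m) → Assignment n m → Set
IsMinNAE {n} {m} F σ = IsNAE F σ × ((τ : Assignment n m) → IsNAE F τ → countTrue σ ≤ countTrue τ)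

IsTNAE : ∀ {n m} → List (MClause n m) → ℕ → Set
IsTNAE {n} {m} F t =
  Σ (Assignment n m) (λ σ → IsNAE F σ × countTrue σ ≡ t)
  × ((τ : Assignment n m) → IsNAE F τ → t ≤ countTrue τ)

ExactlyOne2 : Bool → Bool → Set
ExactlyOne2 x y = b2n x + b2n y ≡ 1

ExactlyOne3 : Bool → Bool → Bool → Set
ExactlyOne3 x y w = b2n x + b2n y + b2n w ≡ 1

module Submission where

-- Write K for the number of gadget indices g ∈ U₂ ∖ {z}, so that
-- N = 5K + 1.  The four gadget clauses of g are NAE only if exactly one of
-- α_g, β_g is true (the pair count is 1) and at least one of a_g, b_g, c_g is
-- true; hence every NAE assignment has at least 2 true variables in each
-- gadget block, i.e. at least 2K true variables.  Conversely, "normalizing" a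
-- NAE assignment (a_g := true, b_g := c_g := false, everything else kept)
-- preserves NAE-ness, since the clauses coming from C never mention a, b, c,
-- and leaves exactly 2 true variables per block plus possibly z.  Comparing a
-- minimum assignment with its normalization forces every block to contain
-- exactly 2 true variables, which gives (i), (ii) and countTrue = [z] + 2K.
-- Complementing all variables also preserves NAE-ness, so some NAE
-- assignment has z false; normalizing it reaches the lower bound 2K, whence
-- t_NAE = 2K = 2(N-1)/5.  The file proves the Boolean facts about single
-- clauses first, then list-sum lemmas, then the counting on assignments, and
-- finally assembles the theorem.

open import Defs
open import Data.Nat using (ℕ; _+_; _*_; _∸_; _≤_; z≤n; s≤s)
open import Data.Nat.Properties
  using (≤-refl; ≤-reflexive; *-zeroʳ; ≤-antisym; ≤-trans; +-mono-≤; +-monoˡ-≤; +-monoʳ-≤; +-cancelˡ-≤; +-cancelʳ-≤;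
         m≤m+n; m≤n+m; *-suc; +-comm; +-suc; suc-injective; m≢1+m+n; m≢1+n+m)
open import Data.Nat.ListAction using (sum)
open import Data.Nat.Solver using (module +-*-Solver)
open import Data.Bool using (Bool; true; false; _∨_; _∧_; not)
open import Data.Vec using (Vec; lookup)
open import Data.Sum using (inj₁; inj₂)
open import Data.Product using (Σ; _×_; _,_)
open import Data.List using (List; []; _∷_; map; concatMap; length; allFin)
open import Data.List.Relation.Unary.All as All using (All; []; _∷_)
open import Data.List.Relation.Unary.All.Properties using (++⁻ˡ; ++⁻ʳ; ++⁺; concat⁺; concat⁻; map⁺; map⁻)
open import Data.List.Membership.Propositional using (_∈_)
open import Data.List.Membership.Propositional.Properties using (∈-allFin; ∈-++⁺ˡ; ∈-++⁺ʳ; ∈-map⁺)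
open import Data.Empty using (⊥-elim)
open import Function.Bundles using (_⇔_; mk⇔)
open import Relation.Binary.PropositionalEquality using (_≡_; refl; sym; trans; cong; cong₂; subst; subst₂)

-- The NAE condition on three Boolean values; NAEClause σ (p , q , r) is
-- definitionally NAE3 (σ p) (σ q) (σ r).
NAE3 : Bool → Bool → Bool → Set
NAE3 x y w = ((x ∨ y ∨ w) ≡ true) × ((x ∧ y ∧ w) ≡ false)

NAE3-some-true : ∀ x y w → NAE3 x y w → 1 ≤ b2n x + b2n y + b2n w
NAE3-some-true true  _     _     _        = s≤s z≤n
NAE3-some-true false true  _     _        = s≤s z≤n
NAE3-some-true false false true  _        = s≤s z≤n
NAE3-some-true false false false (() , _)

NAE3-not : ∀ x y w → NAE3 x y w → NAE3 (not x) (not y) (not w)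
NAE3-not true  true  true  (_ , ())
NAE3-not true  true  false _        = refl , refl
NAE3-not true  false _     _        = refl , refl
NAE3-not false true  _     _        = refl , refl
NAE3-not false false true  _        = refl , refl
NAE3-not false false false (() , _)

exactly-one⇒NAE3 : ∀ x y w → ExactlyOne2 x y → NAE3 x y w
exactly-one⇒NAE3 true  false _     _  = refl , refl
exactly-one⇒NAE3 false true  true  _  = refl , refl
exactly-one⇒NAE3 false true  false _  = refl , refl
exactly-one⇒NAE3 true  true  _     ()
exactly-one⇒NAE3 false false _     ()

-- The gadget (x ∨ y ∨ p)(x ∨ y ∨ q)(x ∨ y ∨ r)(p ∨ q ∨ r) is NAE only if
-- exactly one of x, y is true: if x = y, the first three clauses force
-- p = q = r = not x, violating the fourth.
gadget-exactly-one : ∀ x y p q r → NAE3 x y p → NAE3 x y q → NAE3 x y r → NAE3 p q r →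
                     ExactlyOne2 x y
gadget-exactly-one true  false _     _     _     _        _        _        _        = refl
gadget-exactly-one false true  _     _     _     _        _        _        _        = refl
gadget-exactly-one true  true  true  _     _     (_ , ()) _        _        _
gadget-exactly-one true  true  false true  _     _        (_ , ()) _        _
gadget-exactly-one true  true  false false true  _        _        (_ , ()) _
gadget-exactly-one true  true  false false false _        _        _        (() , _)
gadget-exactly-one false false false _     _     (() , _) _        _        _
gadget-exactly-one false false true  false _     _        (() , _) _        _
gadget-exactly-one false false true  true  false _        _        (() , _) _
gadget-exactly-one false false true  true  true  _        _        _        (_ , ())

module _ {A : Set} (f : A → ℕ) (k : ℕ) where

  sum-map-const : ∀ xs → All (λ x → f x ≡ k) xs → sum (map f xs) ≡ k * length xs
  sum-map-const []       []         = sym (*-zeroʳ k)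
  sum-map-const (x ∷ xs) (fx ∷ fxs) =
    trans (cong₂ _+_ fx (sum-map-const xs fxs)) (sym (*-suc k (length xs)))

  sum-map-≥ : ∀ xs → All (λ x → k ≤ f x) xs → k * length xs ≤ sum (map f xs)
  sum-map-≥ []       []         = ≤-reflexive (*-zeroʳ k)
  sum-map-≥ (x ∷ xs) (fx ∷ fxs) =
    subst (_≤ f x + sum (map f xs)) (sym (*-suc k (length xs))) (+-mono-≤ fx (sum-map-≥ xs fxs))

  sum-map-tight : ∀ xs → All (λ x → k ≤ f x) xs → sum (map f xs) ≤ k * length xs →
                  All (λ x → f x ≡ k) xs
  sum-map-tight []       []         _     = []
  sum-map-tight (x ∷ xs) (fx ∷ fxs) total =
    ≤-antisym head-≤ fx ∷ sum-map-tight xs fxs tail-≤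
    where
    total′ : f x + sum (map f xs) ≤ k + k * length xs
    total′ = subst (f x + sum (map f xs) ≤_) (*-suc k (length xs)) total
    head-≤ : f x ≤ k
    head-≤ = +-cancelʳ-≤ (sum (map f xs)) (f x) k
               (≤-trans total′ (+-monoʳ-≤ k (sum-map-≥ xs fxs)))
    tail-≤ : sum (map f xs) ≤ k * length xs
    tail-≤ = +-cancelˡ-≤ k _ _ (≤-trans (+-monoˡ-≤ (sum (map f xs)) fx) total′)

All-concatMap-transfer : ∀ {A B : Set} {P Q : B → Set} (f : A → List B) xs →
  (∀ x → All P (f x) → All Q (f x)) → All P (concatMap f xs) → All Q (concatMap f xs)
All-concatMap-transfer f xs transfer h =
  concat⁺ (map⁺ (All.map (λ {x} → transfer x) (map⁻ {xs = xs} (concat⁻ h))))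

numGadgets : ℕ → ℕ → ℕ
numGadgets n m = length (allG n m)

module _ {n m : ℕ} where

  literalClauses : Vec (Clause n) m → List (MClause n m)
  literalClauses C = concatMap (λ r → clausesOfC r (lookup C r)) (allFin m)

  blockVars : G n m → List (V n m)
  blockVars g = α g ∷ β g ∷ a g ∷ b g ∷ c g ∷ []

  GadgetNAE : Assignment n m → G n m → Set
  GadgetNAE σ g = All (NAEClause σ) (gadget g)

  pairCount tripleCount blockCount : Assignment n m → G n m → ℕ
  pairCount   σ g = b2n (σ (α g)) + b2n (σ (β g))
  tripleCount σ g = b2n (σ (a g)) + b2n (σ (b g)) + b2n (σ (c g))
  blockCount  σ g = pairCount σ g + tripleCount σ g

  allG-complete : ∀ g → g ∈ allG n m
  allG-complete (inj₁ i) = ∈-++⁺ˡ (∈-map⁺ inj₁ (∈-allFin i))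
  allG-complete (inj₂ r) = ∈-++⁺ʳ (map inj₁ (allFin n)) (∈-map⁺ inj₂ (∈-allFin r))

  gadgets-of : ∀ (C : Vec (Clause n) m) σ → IsNAE (MNAE C) σ → (g : G n m) → GadgetNAE σ g
  gadgets-of C σ nae g =
    All.lookup (map⁻ {xs = allG n m} (concat⁻ (++⁻ʳ (literalClauses C) nae))) (allG-complete g)

  gadget-pair : ∀ σ g → GadgetNAE σ g → pairCount σ g ≡ 1
  gadget-pair σ g (h₁ ∷ h₂ ∷ h₃ ∷ h₄ ∷ []) =
    gadget-exactly-one (σ (α g)) (σ (β g)) (σ (a g)) (σ (b g)) (σ (c g)) h₁ h₂ h₃ h₄

  gadget-triple : ∀ σ g → GadgetNAE σ g → 1 ≤ tripleCount σ g
  gadget-triple σ g (_ ∷ _ ∷ _ ∷ h₄ ∷ []) = NAE3-some-true (σ (a g)) (σ (b g)) (σ (c g)) h₄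

  gadget-block-≥2 : ∀ σ g → GadgetNAE σ g → 2 ≤ blockCount σ g
  gadget-block-≥2 σ g h =
    subst (λ p → 2 ≤ p + tripleCount σ g) (sym (gadget-pair σ g h)) (s≤s (gadget-triple σ g h))

  countTrue-blocks : ∀ σ → countTrue σ ≡ b2n (σ z) + sum (map (blockCount σ) (allG n m))
  countTrue-blocks σ = cong (b2n (σ z) +_) (blocks (allG n m))
    where
    open +-*-Solver
    blocks : ∀ gs → sum (map (λ v → b2n (σ v)) (concatMap blockVars gs))
                    ≡ sum (map (blockCount σ) gs)
    blocks []       = refl
    blocks (g ∷ gs) = trans
      (solve 6 (λ A B P Q R S → A :+ (B :+ (P :+ (Q :+ (R :+ S))))
                                := ((A :+ B) :+ ((P :+ Q) :+ R)) :+ S) refl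
        (b2n (σ (α g))) (b2n (σ (β g))) (b2n (σ (a g))) (b2n (σ (b g))) (b2n (σ (c g)))
        (sum (map (λ v → b2n (σ v)) (concatMap blockVars gs))))
      (cong (blockCount σ g +_) (blocks gs))

  -- N - 1 = 5K: besides z, U₃ consists of K blocks of five variables.
  N-size : N n m ∸ 1 ≡ 5 * numGadgets n m
  N-size = blocks (allG n m)
    where
    blocks : ∀ gs → length (concatMap blockVars gs) ≡ 5 * length gs
    blocks []       = refl
    blocks (g ∷ gs) = trans (cong (5 +_) (blocks gs)) (sym (*-suc 5 (length gs)))

  count-≥ : ∀ (C : Vec (Clause n) m) τ → IsNAE (MNAE C) τ → 2 * numGadgets n m ≤ countTrue τ
  count-≥ C τ nae = subst (2 * numGadgets n m ≤_) (sym (countTrue-blocks τ))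
    (≤-trans (sum-map-≥ (blockCount τ) 2 (allG n m)
                (All.tabulate (λ {g} _ → gadget-block-≥2 τ g (gadgets-of C τ nae g))))
             (m≤n+m _ (b2n (τ z))))

  complement : Assignment n m → Assignment n m
  complement σ v = not (σ v)

  complement-NAE : ∀ (F : List (MClause n m)) σ → IsNAE F σ → IsNAE F (complement σ)
  complement-NAE F σ = All.map (λ { {p , q , r} h → NAE3-not (σ p) (σ q) (σ r) h })

  NAE-with-z-false : ∀ (F : List (MClause n m)) σ → IsNAE F σ →
                     Σ (Assignment n m) (λ ρ → IsNAE F ρ × ρ z ≡ false)
  NAE-with-z-false F σ nae with σ z in σz
  ... | true  = complement σ , complement-NAE F σ nae , cong not σz
  ... | false = σ , nae , σz

  normalize : Assignment n m → Assignment n m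
  normalize σ z     = σ z
  normalize σ (α g) = σ (α g)
  normalize σ (β g) = σ (β g)
  normalize σ (a g) = true
  normalize σ (b g) = false
  normalize σ (c g) = false

  NAEClause-cong : ∀ (σ τ : Assignment n m) p q r → σ p ≡ τ p → σ q ≡ τ q → σ r ≡ τ r →
                   NAEClause σ (p , q , r) → NAEClause τ (p , q , r)
  NAEClause-cong σ τ p q r ep eq er h =
    subst₂ (λ u v → NAE3 u v (τ r)) ep eq (subst (NAE3 (σ p) (σ q)) er h)

  normalize-γ : ∀ σ u pol → σ (γ u pol) ≡ normalize σ (γ u pol)
  normalize-γ σ u true  = refl
  normalize-γ σ u false = refl

  -- Clauses coming from C only involve z, α and β, on which normalize σ agrees with σ.
  normalize-clausesOfC : ∀ σ r cl → All (NAEClause σ) (clausesOfC r cl) →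
                         All (NAEClause (normalize σ)) (clausesOfC r cl)
  normalize-clausesOfC σ r (clause i j k _ _ pi pj pk) (h₁ ∷ h₂ ∷ []) =
      NAEClause-cong σ (normalize σ) _ _ _ (normalize-γ σ i pi) (normalize-γ σ j pj) refl h₁
    ∷ NAEClause-cong σ (normalize σ) _ _ _ refl (normalize-γ σ k pk) refl h₂
    ∷ []

  -- A normalized NAE gadget stays NAE: exactly one of α_g, β_g is true, and
  -- (a_g, b_g, c_g) = (true, false, false).
  normalize-gadget : ∀ σ g → GadgetNAE σ g → GadgetNAE (normalize σ) g
  normalize-gadget σ g h =
      exactly-one⇒NAE3 x y true  one
    ∷ exactly-one⇒NAE3 x y false one
    ∷ exactly-one⇒NAE3 x y false one
    ∷ (refl , refl)
    ∷ []
    where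
    x = σ (α g)
    y = σ (β g)
    one = gadget-pair σ g h

  normalize-NAE : ∀ (C : Vec (Clause n) m) σ → IsNAE (MNAE C) σ → IsNAE (MNAE C) (normalize σ)
  normalize-NAE C σ nae = ++⁺
    (All-concatMap-transfer (λ r → clausesOfC r (lookup C r)) (allFin m)
       (λ r → normalize-clausesOfC σ r (lookup C r)) (++⁻ˡ (literalClauses C) nae))
    (All-concatMap-transfer gadget (allG n m) (normalize-gadget σ)
       (++⁻ʳ (literalClauses C) nae))

  count-normalize : ∀ (C : Vec (Clause n) m) σ → IsNAE (MNAE C) σ →
                    countTrue (normalize σ) ≡ b2n (σ z) + 2 * numGadgets n m
  count-normalize C σ nae = trans (countTrue-blocks (normalize σ))
    (cong (b2n (σ z) +_) (sum-map-const (blockCount (normalize σ)) 2 (allG n m)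
      (All.tabulate (λ {g} _ → cong (_+ 1) (gadget-pair σ g (gadgets-of C σ nae g))))))

  -- A minimum NAE assignment has exactly 2 true variables in every block:
  -- it has at least 2 per block, and at most as many as its normalization.
  minimal-blocks : ∀ (C : Vec (Clause n) m) σ → IsMinNAE (MNAE C) σ →
                   All (λ g → blockCount σ g ≡ 2) (allG n m)
  minimal-blocks C σ (nae , minimal) =
    sum-map-tight (blockCount σ) 2 (allG n m)
      (All.tabulate (λ {g} _ → gadget-block-≥2 σ g (gadgets-of C σ nae g)))
      (+-cancelˡ-≤ (b2n (σ z)) _ _
        (subst₂ _≤_ (countTrue-blocks σ) (count-normalize C σ nae)
          (minimal (normalize σ) (normalize-NAE C σ nae))))

  minimal-count : ∀ (C : Vec (Clause n) m) σ → IsMinNAE (MNAE C) σ →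
                  countTrue σ ≡ b2n (σ z) + 2 * numGadgets n m
  minimal-count C σ min = trans (countTrue-blocks σ)
    (cong (b2n (σ z) +_) (sum-map-const (blockCount σ) 2 (allG n m) (minimal-blocks C σ min)))

  -- (ii): with pairCount = 1 and blockCount = 2, the triple count is 1.
  minimal-triple : ∀ (C : Vec (Clause n) m) σ → IsMinNAE (MNAE C) σ →
                   (g : G n m) → ExactlyOne3 (σ (a g)) (σ (b g)) (σ (c g))
  minimal-triple C σ min@(nae , _) g = suc-injective
    (trans (cong (_+ tripleCount σ g) (sym (gadget-pair σ g (gadgets-of C σ nae g))))
           (All.lookup (minimal-blocks C σ min) (allG-complete g)))

five-two : ∀ K → 5 * (2 * K) ≡ 2 * (5 * K)
five-two = solve 1 (λ K → con 5 :* (con 2 :* K) := con 2 :* (con 5 :* K)) refl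
  where open +-*-Solver

five-one-two : ∀ K → 5 * (1 + 2 * K) ≡ 5 + 2 * (5 * K)
five-one-two = solve 1 (λ K → con 5 :* (con 1 :+ con 2 :* K) := con 5 :+ con 2 :* (con 5 :* K)) refl
  where open +-*-Solver

value-low : ∀ bz K → (5 * (b2n bz + 2 * K) ≡ 2 * (5 * K)) ⇔ (bz ≡ false)
value-low false K = mk⇔ (λ _ → refl) (λ _ → five-two K)
value-low true  K = mk⇔ (λ eq → ⊥-elim (m≢1+n+m (2 * (5 * K)) {4} (sym (trans (sym (five-one-two K)) eq))))
                        (λ ())

value-high : ∀ bz K → (5 * (b2n bz + 2 * K) ≡ 2 * (5 * K) + 5) ⇔ (bz ≡ true)
value-high true  K = mk⇔ (λ _ → refl) (λ _ → trans (five-one-two K) (+-comm 5 _))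
value-high false K = mk⇔ (λ eq → ⊥-elim (m≢1+m+n (2 * (5 * K)) {4}
                                   (trans (trans (sym (five-two K)) eq) (+-suc _ 4))))
                         (λ ())

module _ {n m : ℕ} (C : Vec (Clause n) m) where

  minimal-structure : (σ : Assignment n m) → IsMinNAE (MNAE C) σ →
        ((g : G n m) → ExactlyOne2 (σ (α g)) (σ (β g)))
      × ((g : G n m) → ExactlyOne3 (σ (a g)) (σ (b g)) (σ (c g)))
      × ((5 * countTrue σ ≡ 2 * (N n m ∸ 1)) ⇔ (σ z ≡ false))
      × ((5 * countTrue σ ≡ 2 * (N n m ∸ 1) + 5) ⇔ (σ z ≡ true))
  minimal-structure σ min@(nae , _) =
    (λ g → gadget-pair σ g (gadgets-of C σ nae g)) , minimal-triple C σ min , extremes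
    where
    extremes : ((5 * countTrue σ ≡ 2 * (N n m ∸ 1)) ⇔ (σ z ≡ false))
             × ((5 * countTrue σ ≡ 2 * (N n m ∸ 1) + 5) ⇔ (σ z ≡ true))
    extremes rewrite minimal-count C σ min | N-size {n} {m} =
      value-low (σ z) (numGadgets n m) , value-high (σ z) (numGadgets n m)

  -- t_NAE(F) = 2K, attained by normalizing a NAE assignment with z false.
  t-NAE : Σ (Assignment n m) (IsNAE (MNAE C)) → IsTNAE (MNAE C) (2 * numGadgets n m)
  t-NAE (σ , nae) with NAE-with-z-false (MNAE C) σ nae
  ... | ρ , naeρ , ρz =
    (normalize ρ , normalize-NAE C ρ naeρ ,
       trans (count-normalize C ρ naeρ) (cong (λ bz → b2n bz + 2 * numGadgets n m) ρz))
    , count-≥ C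

claim8 : (n m : ℕ) (C : Vec (Clause n) m) →
    Σ (Assignment n m) (IsNAE (MNAE C)) →
    ((σ : Assignment n m) → IsMinNAE (MNAE C) σ →
        ((g : G n m) → ExactlyOne2 (σ (α g)) (σ (β g)))
      × ((g : G n m) → ExactlyOne3 (σ (a g)) (σ (b g)) (σ (c g)))
      × ((5 * countTrue σ ≡ 2 * (N n m ∸ 1)) ⇔ (σ z ≡ false))
      × ((5 * countTrue σ ≡ 2 * (N n m ∸ 1) + 5) ⇔ (σ z ≡ true)))
    × Σ ℕ (λ t → IsTNAE (MNAE C) t
        × (2 * (N n m ∸ 1) ≤ 5 * t)
        × (5 * t ≤ 2 * (N n m ∸ 1) + 5))
claim8 n m C nae = minimal-structure C , 2 * numGadgets n m , t-NAE C nae , bounds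
  where
  bounds : (2 * (N n m ∸ 1) ≤ 5 * (2 * numGadgets n m))
         × (5 * (2 * numGadgets n m) ≤ 2 * (N n m ∸ 1) + 5)
  bounds rewrite N-size {n} {m} | five-two (numGadgets n m) = ≤-refl , m≤m+n _ 5
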